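{- Let $k\ge 2$ and let $n=r+m(k+1)$ with integers $m\ge 0$ and $r\in\{0,1,\ldots,k\}$. Then: (i) if $r=0$, then $L_n^{(k)}\equiv 2(-1)^m \pmod{2^{k-2}}$; (ii) if $r=1$, then $L_n^{(k)}\equiv (4m+1)(-1)^m \pmod{2^{k-1}}$; (iii) if $r=2$, then $L_n^{(k)}\equiv (4m^2+6m+3)(-1)^m \pmod{2^{k}}$; (iv) if $r\ge 3$, then $$L_n^{(k)}\equiv (-1)^m 2^{r-2}\left(4\left(\binom{m+r+1}{m}-\binom{m+r-1}{m-2}\right)-\left(\binom{m+r}{m}-\binom{m+r-2}{m-2}\right)\right)\pmod{2^{k+r-2}}.$$
   Context: For an integer $k\ge 2$, the $k$-generalized Lucas sequence $\{L_n^{(k)}\}_{n\ge 2-k}$ is defined by $L_{2-k}^{(k)}=\cdots=L_{ -1}^{(k)}=0$, $L_0^{(k)}=2$, $L_1^{(k)}=1$, and $L_n^{(k)}=L_{n-1}^{(k)}+\cdots+L_{n-k}^{(k)}$ for $n\ge 2$. Convention: a binomial coefficient $\binom{a}{b}$ is taken to be $0$ if $a<b$ or if $a$ or $b$ is negative. -}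

module Defs where

open import Data.Nat using (ℕ; zero; suc; _+_; _∸_; _<_)
open import Data.Nat.Combinatorics using (_C_)
open import Data.List using (List; []; _∷_; take)
open import Data.Nat.ListAction using (sum)
open import Data.Integer as ℤ using (ℤ; +_; -_; _-_)
open import Data.Integer.Divisibility using (_∣_)

-- history of the k-generalized Lucas sequence:
-- lucasHist k n = [ L_n , L_{n-1} , … , L_0 ]  (terms with negative index are 0
-- and hence omitted; 'take k' of this list gives exactly the nonzero summands)
lucasHist : ℕ → ℕ → List ℕ
lucasHist k zero = 2 ∷ []
lucasHist k (suc zero) = 1 ∷ 2 ∷ []
lucasHist k (suc (suc n)) = step (lucasHist k (suc n))
  where
  step : List ℕ → List ℕ
  step h = sum (take k h) ∷ h

headOr0 : List ℕ → ℕ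
headOr0 [] = 0
headOr0 (x ∷ _) = x

L : ℕ → ℕ → ℕ
L k n = headOr0 (lucasHist k n)

sgn : ℕ → ℤ
sgn zero = + 1
sgn (suc m) = - sgn m

_≡_[mod_] : ℤ → ℤ → ℤ → Set
a ≡ b [mod d ] = d ∣ (a - b)

-- binomShift m r = binomial coefficient C(m + r - 2, m - 2), which is 0 when m < 2
-- (paper's convention: negative lower index gives 0)
binomShift : ℕ → ℕ → ℕ
binomShift zero r = 0
binomShift (suc zero) r = 0
binomShift (suc (suc j)) r = (j + r) C j

-- For n ≥ k the k-generalized Lucas numbers satisfy L_{n+1} = 2 L_n − L_{n−k}.
-- Writing a(m, r) = L_{r+m(k+1)} for 0 ≤ r ≤ k, this reads
--   a(m+1, r+1) = 2 a(m+1, r) − a(m, r+1),   a(m+1, 0) = 2 a(m, k) − a(m, 0).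
-- The claimed residues w(m, r) (namely 2, 4m+1 and 2^{r−2} B(m, r), B the bracket
-- of the statement) satisfy w(m+1, r+1) = 2 w(m+1, r) + w(m, r+1), which is Pascal's
-- rule for the binomial differences inside B; hence (−1)^m w obeys the same
-- recurrence as a. Row m = 0 agrees exactly (L_r = 3·2^{r−2} for 2 ≤ r ≤ k), and the
-- congruence a ≡ (−1)^m w modulo 2^{k−2+r} propagates along the recurrence: the
-- doubling gains one factor of 2, and in the wrap-around step 2^{k−2} divides
-- a(m, k) because it divides w(m, k).
module Submission where

open import Data.List using (List; []; _∷_; take; drop)
open import Data.List.Properties using (take-[]; drop-[])
open import Data.Nat as ℕ using (ℕ; zero; suc; _+_; _*_; _^_; _∸_; _≤_; _<_; s≤s; z≤n)
open import Data.Nat.Combinatorics using (_C_; nCn≡1; nCk+nC[k+1]≡[n+1]C[k+1])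
open import Data.Nat.Divisibility using (n∣m*n)
open import Data.Nat.ListAction using (sum)
open import Data.Nat.Properties
  using (+-suc; +-identityʳ; +-assoc; +-comm; ^-distribˡ-+-*; ≤-refl; <⇒≤)
import Data.Nat.Tactic.RingSolver as ℕ-Solver
open import Data.Integer as ℤ using (ℤ; +_; -_; _-_)
open import Data.Integer.Divisibility.Signed
  using (_∣_; divides; ∣ᵤ⇒∣; ∣⇒∣ᵤ; ∣-refl; ∣-trans; ∣m⇒∣-m; ∣m∣n⇒∣m-n;
         ∣m+n∣n⇒∣m; ∣n⇒∣m*n; ∣m⇒∣m*n; *-monoʳ-∣)
open import Data.Integer.Properties using (pos-*; *-identityˡ; *-assoc; *-comm; neg-distribˡ-*)
open import Data.Integer.Tactic.RingSolver using (solve-∀)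
open import Data.Product using (_×_; _,_)
open import Relation.Binary.PropositionalEquality
open ≡-Reasoning
open import Defs

sum-take-suc : ∀ i (xs : List ℕ) →
  sum (take (suc i) xs) ≡ sum (take i xs) + headOr0 (drop i xs)
sum-take-suc zero [] = refl
sum-take-suc zero (x ∷ xs) = +-identityʳ x
sum-take-suc (suc i) [] = refl
sum-take-suc (suc i) (x ∷ xs) =
  trans (cong (x ℕ.+_) (sum-take-suc i xs)) (sym (+-assoc x _ _))

lucasHist-suc : ∀ k n → lucasHist k (suc n) ≡ L k (suc n) ∷ lucasHist k n
lucasHist-suc k zero = refl
lucasHist-suc k (suc n) = refl

drop-lucasHist : ∀ k i n → drop i (lucasHist k (i + n)) ≡ lucasHist k n
drop-lucasHist k zero n = refl
drop-lucasHist k (suc i) n rewrite lucasHist-suc k (i + n) = drop-lucasHist k i n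

drop-lucasHist-beyond : ∀ k {i n} → n < i → drop i (lucasHist k n) ≡ []
drop-lucasHist-beyond k {suc i} {zero} _ = drop-[] i
drop-lucasHist-beyond k {suc i} {suc n} (s≤s n<i)
  rewrite lucasHist-suc k n = drop-lucasHist-beyond k n<i

-- The second summand is L_{n+2−k}, or 0 while that index is negative.
L-recurrence-hist : ∀ k n →
  L (suc k) (3 + n) + headOr0 (drop k (lucasHist (suc k) (1 + n)))
    ≡ L (suc k) (2 + n) + L (suc k) (2 + n)
L-recurrence-hist k n = begin
  L (suc k) (2 + n) + sum (take k hist) + headOr0 (drop k hist)
    ≡⟨ +-assoc (L (suc k) (2 + n)) _ _ ⟩
  L (suc k) (2 + n) + (sum (take k hist) + headOr0 (drop k hist))
    ≡⟨ cong (L (suc k) (2 + n) ℕ.+_) (sym (sum-take-suc k hist)) ⟩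
  L (suc k) (2 + n) + L (suc k) (2 + n) ∎
  where
  hist : List ℕ
  hist = lucasHist (suc k) (1 + n)

x+c≡b+b⇒x≡2b-c : ∀ {x b c} → x + c ≡ b + b → + x ≡ + 2 ℤ.* + b - + c
x+c≡b+b⇒x≡2b-c {x} {b} {c} eq = begin
  + x                          ≡⟨ add-sub (+ x) (+ c) ⟩
  (+ x ℤ.+ + c) - + c          ≡⟨ cong (λ y → + y - + c) eq ⟩
  (+ b ℤ.+ + b) - + c          ≡⟨ double (+ b) (+ c) ⟩
  + 2 ℤ.* + b - + c            ∎
  where
  add-sub : ∀ x c → x ≡ (x ℤ.+ c) - c
  add-sub = solve-∀
  double : ∀ b c → (b ℤ.+ b) - c ≡ + 2 ℤ.* b - c
  double = solve-∀

2^e∣x⇒2^[1+e]∣2*x : ∀ {e x} → + (2 ^ e) ∣ x → + (2 ^ suc e) ∣ + 2 ℤ.* x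
2^e∣x⇒2^[1+e]∣2*x {e} {x} d =
  subst (_∣ + 2 ℤ.* x) (sym (pos-* 2 (2 ^ e))) (*-monoʳ-∣ (+ 2) d)

2^[m+n]∣x⇒2^n∣x : ∀ m n {x} → + (2 ^ (m + n)) ∣ x → + (2 ^ n) ∣ x
2^[m+n]∣x⇒2^n∣x m n = ∣-trans
  (subst (λ y → + (2 ^ n) ∣ + y) (sym (^-distribˡ-+-* 2 m n)) (∣ᵤ⇒∣ (n∣m*n (2 ^ m))))

double-sub-congruence : ∀ {e x y u v} →
  + (2 ^ e) ∣ x - u → + (2 ^ suc e) ∣ y - v →
  + (2 ^ suc e) ∣ (+ 2 ℤ.* x - y) - (+ 2 ℤ.* u - v)
double-sub-congruence {e} {x} {y} {u} {v} x≡u y≡v =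
  subst (+ (2 ^ suc e) ∣_) (sym (regroup x y u v))
    (∣m∣n⇒∣m-n (2^e∣x⇒2^[1+e]∣2*x {e} x≡u) y≡v)
  where
  regroup : ∀ x y u v → (+ 2 ℤ.* x - y) - (+ 2 ℤ.* u - v) ≡ + 2 ℤ.* (x - u) - (y - v)
  regroup = solve-∀

double-sub-congruence-neg : ∀ {d x y v} →
  d ∣ x → d ∣ y - v → d ∣ (+ 2 ℤ.* x - y) - (- v)
double-sub-congruence-neg {d} {x} {y} {v} d∣x y≡v =
  subst (d ∣_) (sym (regroup x y v)) (∣m∣n⇒∣m-n (∣n⇒∣m*n (+ 2) d∣x) y≡v)
  where
  regroup : ∀ x y v → (+ 2 ℤ.* x - y) - (- v) ≡ + 2 ℤ.* x - (y - v)
  regroup = solve-∀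

C-pascal : ∀ m r → (suc m + suc r) C suc m ≡ (suc m + r) C suc m + (m + suc r) C m
C-pascal m r rewrite +-suc m r =
  trans (sym (nCk+nC[k+1]≡[n+1]C[k+1] (suc (m + r)) m)) (+-comm (suc (m + r) C m) _)

binomShift-pascal : ∀ m r →
  binomShift (suc m) (suc r) ≡ binomShift (suc m) r + binomShift m (suc r)
binomShift-pascal zero r = refl
binomShift-pascal (suc zero) r = refl
binomShift-pascal (suc (suc i)) r = C-pascal i r

binomDiff : ℕ → ℕ → ℤ
binomDiff m r = + ((m + r) C m) - + binomShift m r

binomDiff-pascal : ∀ m r →
  binomDiff (suc m) (suc r) ≡ binomDiff (suc m) r ℤ.+ binomDiff m (suc r)
binomDiff-pascal m r =
  trans (cong₂ (λ a b → + a - + b) (C-pascal m r) (binomShift-pascal m r))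
        (regroup (+ ((suc m + r) C suc m)) (+ ((m + suc r) C m))
                 (+ binomShift (suc m) r) (+ binomShift m (suc r)))
  where
  regroup : ∀ a b c d → (a ℤ.+ b) - (c ℤ.+ d) ≡ (a - c) ℤ.+ (b - d)
  regroup = solve-∀

binomDiff-1 : ∀ m → binomDiff (suc m) 1 ≡ + 2
binomDiff-1 zero = refl
binomDiff-1 (suc m) = begin
  binomDiff (suc (suc m)) 1                         ≡⟨ binomDiff-pascal (suc m) 0 ⟩
  binomDiff (suc (suc m)) 0 ℤ.+ binomDiff (suc m) 1 ≡⟨ cong₂ ℤ._+_ diff-0 (binomDiff-1 m) ⟩
  + 2                                               ∎
  where
  nC-diagonal : ∀ n → (n + 0) C n ≡ 1
  nC-diagonal n = trans (cong (_C n) (+-identityʳ n)) (nCn≡1 n)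
  diff-0 : binomDiff (suc (suc m)) 0 ≡ + 0
  diff-0 = cong₂ (λ a b → + a - + b) (nC-diagonal (suc (suc m))) (nC-diagonal m)

binomDiff-2 : ∀ m → binomDiff m 2 ≡ + (2 * m + 1)
binomDiff-2 zero = refl
binomDiff-2 (suc m) = begin
  binomDiff (suc m) 2                         ≡⟨ binomDiff-pascal m 1 ⟩
  binomDiff (suc m) 1 ℤ.+ binomDiff m 2       ≡⟨ cong₂ ℤ._+_ (binomDiff-1 m) (binomDiff-2 m) ⟩
  + (2 + (2 * m + 1))                         ≡⟨ cong +_ (arith m) ⟩
  + (2 * suc m + 1)                           ∎
  where
  arith : ∀ m → 2 + (2 * m + 1) ≡ 2 * suc m + 1
  arith = ℕ-Solver.solve-∀

binomDiff-3 : ∀ m → binomDiff m 3 ≡ + (suc m * suc m)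
binomDiff-3 zero = refl
binomDiff-3 (suc m) = begin
  binomDiff (suc m) 3                         ≡⟨ binomDiff-pascal m 2 ⟩
  binomDiff (suc m) 2 ℤ.+ binomDiff m 3       ≡⟨ cong₂ ℤ._+_ (binomDiff-2 (suc m)) (binomDiff-3 m) ⟩
  + ((2 * suc m + 1) + suc m * suc m)         ≡⟨ cong +_ (arith m) ⟩
  + (suc (suc m) * suc (suc m))               ∎
  where
  arith : ∀ m → (2 * suc m + 1) + suc m * suc m ≡ suc (suc m) * suc (suc m)
  arith = ℕ-Solver.solve-∀

coeff : ℕ → ℕ → ℤ
coeff m r = + 4 ℤ.* binomDiff m (suc r) - binomDiff m r

coeff-pascal : ∀ m r → coeff (suc m) (suc r) ≡ coeff (suc m) r ℤ.+ coeff m (suc r)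
coeff-pascal m r = begin
  + 4 ℤ.* binomDiff (suc m) (suc (suc r)) - binomDiff (suc m) (suc r)
    ≡⟨ cong₂ (λ a b → + 4 ℤ.* a - b) (binomDiff-pascal m (suc r)) (binomDiff-pascal m r) ⟩
  + 4 ℤ.* (binomDiff (suc m) (suc r) ℤ.+ binomDiff m (suc (suc r)))
    - (binomDiff (suc m) r ℤ.+ binomDiff m (suc r))
    ≡⟨ regroup (binomDiff (suc m) (suc r)) (binomDiff m (suc (suc r)))
               (binomDiff (suc m) r) (binomDiff m (suc r)) ⟩
  coeff (suc m) r ℤ.+ coeff m (suc r) ∎
  where
  regroup : ∀ a b c d → + 4 ℤ.* (a ℤ.+ b) - (c ℤ.+ d) ≡ (+ 4 ℤ.* a - c) ℤ.+ (+ 4 ℤ.* b - d)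
  regroup = solve-∀

coeff-2 : ∀ m → coeff m 2 ≡ + (4 * m * m + 6 * m + 3)
coeff-2 m = begin
  + 4 ℤ.* binomDiff m 3 - binomDiff m 2
    ≡⟨ cong₂ (λ a b → + 4 ℤ.* a - b) (binomDiff-3 m) (binomDiff-2 m) ⟩
  + 4 ℤ.* + (suc m * suc m) - + (2 * m + 1)
    ≡⟨ cong (_- + (2 * m + 1)) (sym (pos-* 4 (suc m * suc m))) ⟩
  + (4 * (suc m * suc m)) - + (2 * m + 1)
    ≡⟨ cong (λ a → + a - + (2 * m + 1)) (arith m) ⟩
  + (2 * m + 1) ℤ.+ + (4 * m * m + 6 * m + 3) - + (2 * m + 1)
    ≡⟨ cancel (+ (2 * m + 1)) _ ⟩
  + (4 * m * m + 6 * m + 3) ∎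
  where
  arith : ∀ m → 4 * (suc m * suc m) ≡ (2 * m + 1) + (4 * m * m + 6 * m + 3)
  arith = ℕ-Solver.solve-∀
  cancel : ∀ a b → a ℤ.+ b - a ≡ b
  cancel = solve-∀

coeff-statement : ∀ m r →
  + 4 ℤ.* (+ ((m + r + 1) C m) - + binomShift m (r + 1)) - binomDiff m r ≡ coeff m r
coeff-statement m r rewrite +-assoc m r 1 | +-comm r 1 = refl

residue : ℕ → ℕ → ℤ
residue m zero = + 2
residue m (suc zero) = + (4 * m + 1)
residue m (suc (suc i)) = + (2 ^ i) ℤ.* coeff m (2 + i)

residue-pascal : ∀ m r →
  residue (suc m) (suc r) ≡ + 2 ℤ.* residue (suc m) r ℤ.+ residue m (suc r)
residue-pascal m zero = cong +_ (arith m)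
  where
  arith : ∀ m → 4 * suc m + 1 ≡ 4 + (4 * m + 1)
  arith = ℕ-Solver.solve-∀
residue-pascal m (suc zero) = begin
  + 1 ℤ.* coeff (suc m) 2
    ≡⟨ trans (*-identityˡ _) (coeff-2 (suc m)) ⟩
  + (4 * suc m * suc m + 6 * suc m + 3)
    ≡⟨ cong +_ (arith m) ⟩
  + (2 * (4 * suc m + 1) + (4 * m * m + 6 * m + 3))
    ≡⟨ cong₂ ℤ._+_ (pos-* 2 (4 * suc m + 1)) (sym (trans (*-identityˡ _) (coeff-2 m))) ⟩
  + 2 ℤ.* + (4 * suc m + 1) ℤ.+ + 1 ℤ.* coeff m 2 ∎
  where
  arith : ∀ m →
    4 * suc m * suc m + 6 * suc m + 3 ≡ 2 * (4 * suc m + 1) + (4 * m * m + 6 * m + 3)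
  arith = ℕ-Solver.solve-∀
residue-pascal m (suc (suc i)) = begin
  + (2 ^ suc i) ℤ.* coeff (suc m) (3 + i)
    ≡⟨ cong (+ (2 ^ suc i) ℤ.*_) (coeff-pascal m (2 + i)) ⟩
  + (2 ^ suc i) ℤ.* (coeff (suc m) (2 + i) ℤ.+ coeff m (3 + i))
    ≡⟨ cong (λ p → p ℤ.* (coeff (suc m) (2 + i) ℤ.+ coeff m (3 + i))) (pos-* 2 (2 ^ i)) ⟩
  + 2 ℤ.* + (2 ^ i) ℤ.* (coeff (suc m) (2 + i) ℤ.+ coeff m (3 + i))
    ≡⟨ distrib (+ (2 ^ i)) (coeff (suc m) (2 + i)) (coeff m (3 + i)) ⟩
  + 2 ℤ.* (+ (2 ^ i) ℤ.* coeff (suc m) (2 + i)) ℤ.+ + 2 ℤ.* + (2 ^ i) ℤ.* coeff m (3 + i)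
    ≡⟨ cong (λ p → + 2 ℤ.* (+ (2 ^ i) ℤ.* coeff (suc m) (2 + i)) ℤ.+ p ℤ.* coeff m (3 + i))
            (sym (pos-* 2 (2 ^ i))) ⟩
  + 2 ℤ.* (+ (2 ^ i) ℤ.* coeff (suc m) (2 + i)) ℤ.+ + (2 ^ suc i) ℤ.* coeff m (3 + i) ∎
  where
  distrib : ∀ p a b → + 2 ℤ.* p ℤ.* (a ℤ.+ b) ≡ + 2 ℤ.* (p ℤ.* a) ℤ.+ + 2 ℤ.* p ℤ.* b
  distrib = solve-∀

signedResidue : ℕ → ℕ → ℤ
signedResidue m r = sgn m ℤ.* residue m r

signedResidue-step : ∀ m r →
  signedResidue (suc m) (suc r)
    ≡ + 2 ℤ.* signedResidue (suc m) r - signedResidue m (suc r)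
signedResidue-step m r = begin
  - sgn m ℤ.* residue (suc m) (suc r)
    ≡⟨ cong (- sgn m ℤ.*_) (residue-pascal m r) ⟩
  - sgn m ℤ.* (+ 2 ℤ.* residue (suc m) r ℤ.+ residue m (suc r))
    ≡⟨ regroup (sgn m) (residue (suc m) r) (residue m (suc r)) ⟩
  + 2 ℤ.* (- sgn m ℤ.* residue (suc m) r) - sgn m ℤ.* residue m (suc r) ∎
  where
  regroup : ∀ s w w′ → - s ℤ.* (+ 2 ℤ.* w ℤ.+ w′) ≡ + 2 ℤ.* (- s ℤ.* w) - s ℤ.* w′
  regroup = solve-∀

signedResidue-wrap : ∀ m → signedResidue (suc m) 0 ≡ - signedResidue m 0
signedResidue-wrap m = sym (neg-distribˡ-* (sgn m) (+ 2))

module _ (j : ℕ) where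

  private
    k : ℕ
    k = 2 + j

  L-recurrence : ∀ t → + L k (suc (k + t)) ≡ + 2 ℤ.* + L k (k + t) - + L k t
  L-recurrence t = x+c≡b+b⇒x≡2b-c {b = L k (k + t)} (begin
    L k (suc (k + t)) + L k t
      ≡⟨ cong (λ h → L k (suc (k + t)) + headOr0 h) (sym (drop-lucasHist k (suc j) t)) ⟩
    L k (suc (k + t)) + headOr0 (drop (suc j) (lucasHist k (suc j + t)))
      ≡⟨ L-recurrence-hist (suc j) (j + t) ⟩
    L k (k + t) + L k (k + t) ∎)

  L-initial : ∀ i → 2 + i ≤ k → L k (2 + i) ≡ 3 * 2 ^ i
  L-initial zero _ = cong (λ xs → 1 + (2 + sum xs)) (take-[] j)
  L-initial (suc i) 3+i≤k@(s≤s 2+i≤1+j) = begin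
    L k (3 + i)
      ≡⟨ sym (+-identityʳ _) ⟩
    L k (3 + i) + headOr0 []
      ≡⟨ cong (λ h → L k (3 + i) + headOr0 h) (sym (drop-lucasHist-beyond k 2+i≤1+j)) ⟩
    L k (3 + i) + headOr0 (drop (suc j) (lucasHist k (1 + i)))
      ≡⟨ L-recurrence-hist (suc j) i ⟩
    L k (2 + i) + L k (2 + i)
      ≡⟨ cong (λ x → x + x) (L-initial i (<⇒≤ 3+i≤k)) ⟩
    3 * 2 ^ i + 3 * 2 ^ i
      ≡⟨ arith (2 ^ i) ⟩
    3 * 2 ^ suc i ∎
    where
    arith : ∀ p → 3 * p + 3 * p ≡ 3 * (2 * p)
    arith = ℕ-Solver.solve-∀

  grid : ℕ → ℕ → ℤ
  grid m r = + L k (r + m * (k + 1))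

  grid-step : ∀ m r → grid (suc m) (suc r) ≡ + 2 ℤ.* grid (suc m) r - grid m (suc r)
  grid-step m r = begin
    grid (suc m) (suc r)
      ≡⟨ cong (λ n → + L k (suc n)) (shift j m r) ⟩
    + L k (suc (k + grid-index))
      ≡⟨ L-recurrence grid-index ⟩
    + 2 ℤ.* + L k (k + grid-index) - grid m (suc r)
      ≡⟨ cong (λ n → + 2 ℤ.* + L k n - grid m (suc r)) (sym (shift j m r)) ⟩
    + 2 ℤ.* grid (suc m) r - grid m (suc r) ∎
    where
    grid-index : ℕ
    grid-index = suc r + m * (k + 1)
    shift : ∀ j m r → r + suc m * (2 + j + 1) ≡ 2 + j + (suc r + m * (2 + j + 1))
    shift = ℕ-Solver.solve-∀

  grid-wrap : ∀ m → grid (suc m) 0 ≡ + 2 ℤ.* grid m k - grid m 0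
  grid-wrap m = trans (cong (λ n → + L k n) (shift j m)) (L-recurrence (m * (k + 1)))
    where
    shift : ∀ j m → suc m * (2 + j + 1) ≡ suc (2 + j + m * (2 + j + 1))
    shift = ℕ-Solver.solve-∀

  grid-initial : ∀ r → r ≤ k → grid 0 r ≡ residue 0 r
  grid-initial zero _ = refl
  grid-initial (suc zero) _ = refl
  grid-initial (suc (suc i)) 2+i≤k = begin
    + L k (2 + i + 0)    ≡⟨ cong (λ n → + L k (2 + n)) (+-identityʳ i) ⟩
    + L k (2 + i)        ≡⟨ cong +_ (L-initial i 2+i≤k) ⟩
    + (3 * 2 ^ i)        ≡⟨ pos-* 3 (2 ^ i) ⟩
    + 3 ℤ.* + (2 ^ i)    ≡⟨ *-comm (+ 3) (+ (2 ^ i)) ⟩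
    + (2 ^ i) ℤ.* + 3    ∎

  grid≡residue : ∀ m r → r ≤ k → + (2 ^ (r + j)) ∣ grid m r - signedResidue m r
  grid≡residue zero r r≤k = divides (+ 0)
    (trans (cong (_- + 1 ℤ.* residue 0 r) (grid-initial r r≤k)) (x-1*x≡0 (residue 0 r)))
    where
    x-1*x≡0 : ∀ x → x - + 1 ℤ.* x ≡ + 0
    x-1*x≡0 = solve-∀
  grid≡residue (suc m) zero _ =
    subst (+ (2 ^ j) ∣_) (sym (cong₂ _-_ (grid-wrap m) (signedResidue-wrap m)))
      (double-sub-congruence-neg 2^j∣grid-m-k (grid≡residue m 0 z≤n))
    where
    2^j∣residue-m-k : + (2 ^ j) ∣ signedResidue m k
    2^j∣residue-m-k = ∣n⇒∣m*n (sgn m) (∣m⇒∣m*n (coeff m k) ∣-refl)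
    2^j∣grid-m-k : + (2 ^ j) ∣ grid m k
    2^j∣grid-m-k = ∣m+n∣n⇒∣m (2^[m+n]∣x⇒2^n∣x k j (grid≡residue m k ≤-refl))
                             (∣m⇒∣-m 2^j∣residue-m-k)
  grid≡residue (suc m) (suc r) r<k =
    subst (+ (2 ^ suc (r + j)) ∣_) (sym (cong₂ _-_ (grid-step m r) (signedResidue-step m r)))
      (double-sub-congruence {r + j} {grid (suc m) r} {grid m (suc r)}
                             {signedResidue (suc m) r} {signedResidue m (suc r)}
        (grid≡residue (suc m) r (<⇒≤ r<k)) (grid≡residue m (suc r) r<k))

  grid≡statement : ∀ m i → 2 + i ≤ k →
    + (2 ^ (j + (2 + i))) ∣ grid m (2 + i) - sgn m ℤ.* + (2 ^ i)
      ℤ.* (+ 4 ℤ.* (+ ((m + (2 + i) + 1) C m) - + binomShift m (2 + i + 1)) - binomDiff m (2 + i))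
  grid≡statement m i 2+i≤k =
    subst₂ (λ e w → + (2 ^ e) ∣ grid m (2 + i) - w) (+-comm (2 + i) j) reassociate
      (grid≡residue m (2 + i) 2+i≤k)
    where
    reassociate : signedResidue m (2 + i) ≡ sgn m ℤ.* + (2 ^ i)
      ℤ.* (+ 4 ℤ.* (+ ((m + (2 + i) + 1) C m) - + binomShift m (2 + i + 1)) - binomDiff m (2 + i))
    reassociate = trans (sym (*-assoc (sgn m) _ _))
      (cong (sgn m ℤ.* + (2 ^ i) ℤ.*_) (sym (coeff-statement m (2 + i))))

lemma3p1 : (k m r : ℕ) → 2 ≤ k → r ≤ k →
    let n = r ℕ.+ m ℕ.* (k ℕ.+ 1)
        Ln = + L k n
    in ((r ≡ 0) → Ln ≡ sgn m ℤ.* + 2 [mod + (2 ^ (k ∸ 2)) ])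
     × ((r ≡ 1) → Ln ≡ sgn m ℤ.* + (4 ℕ.* m ℕ.+ 1) [mod + (2 ^ (k ∸ 1)) ])
     × ((r ≡ 2) → Ln ≡ sgn m ℤ.* + (4 ℕ.* m ℕ.* m ℕ.+ 6 ℕ.* m ℕ.+ 3) [mod + (2 ^ k) ])
     × (3 ≤ r → Ln ≡ sgn m ℤ.* + (2 ^ (r ∸ 2))
          ℤ.* (+ 4 ℤ.* (+ ((m ℕ.+ r ℕ.+ 1) C m) - + binomShift m (r ℕ.+ 1))
               - (+ ((m ℕ.+ r) C m) - + binomShift m r))
          [mod + (2 ^ (k ℕ.+ r ∸ 2)) ])
lemma3p1 (suc (suc j)) m r (s≤s (s≤s z≤n)) r≤k =
    (λ { refl → ∣⇒∣ᵤ (grid≡residue j m 0 r≤k) })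
  , (λ { refl → ∣⇒∣ᵤ (grid≡residue j m 1 r≤k) })
  , (λ { refl → ∣⇒∣ᵤ (subst (λ w → _ ∣ grid j m 2 - sgn m ℤ.* w)
                            (trans (*-identityˡ _) (coeff-2 m)) (grid≡residue j m 2 r≤k)) })
  , (λ { (s≤s (s≤s (s≤s _))) → ∣⇒∣ᵤ (grid≡statement j m _ r≤k) })
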